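{- For $n\in\mathbb N$ and $(g,v,a,b,c,d,e)\in\mathbb N^7$, define $$\begin{aligned} S(n,g,v,a,b,c,d,e)={}&(c-12^{3g+2})^2+(d-ag)^2+(e-bg)^2+(2^n-2^{g+v})^2\\ &+(2^c-2^{3d+2a})^2+(2^{c+1}-2^{6e+5b})^2 . \end{aligned}$$ Let $n,t\in\mathbb N$ with $n<t$. Then for every $(g,v,a,b,c,d,e)\in\{0,1,\dots,t-1\}^7$, $$0\le S(n,g,v,a,b,c,d,e)<2^{22t+27}.$$
   Context: $\mathbb N=\{0,1,2,\dots\}$. Subtraction in $S$ is ordinary integer subtraction. -}

module Defs where

open import Data.Nat as ℕ using (ℕ; _^_)
open import Data.Integer as ℤ using (ℤ; +_; _-_; _+_; _*_)

sq : ℤ → ℤ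
sq x = x * x

_⊝_ : ℕ → ℕ → ℤ
m ⊝ n = (+ m) - (+ n)

infixl 6 _⊝_

S : ℕ → ℕ → ℕ → ℕ → ℕ → ℕ → ℕ → ℕ → ℤ
S n g v a b c d e =
  sq (c ⊝ 12 ^ (3 ℕ.* g ℕ.+ 2))
  + sq (d ⊝ a ℕ.* g)
  + sq (e ⊝ b ℕ.* g)
  + sq (2 ^ n ⊝ 2 ^ (g ℕ.+ v))
  + sq (2 ^ c ⊝ 2 ^ (3 ℕ.* d ℕ.+ 2 ℕ.* a))
  + sq (2 ^ (c ℕ.+ 1) ⊝ 2 ^ (6 ℕ.* e ℕ.+ 5 ℕ.* b))

module Submission where

open import Defs
open import Data.Nat as ℕ using (ℕ; zero; suc; _^_; _+_; _*_; _≤_; _<_; z≤n)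
open import Data.Nat.Properties
open import Data.Nat.Tactic.RingSolver using (solve-∀)
open import Data.Integer as ℤ using (+_; -[1+_])
import Data.Integer.Properties as ℤ
open import Data.Product using (_×_; _,_)
open import Data.Unit using (tt)
open import Relation.Binary.PropositionalEquality

-- Every summand of S is a square sq (x ⊝ y) with 0 ≤ x, y ≤ B := 2 ^ (11 t + 11),
-- because 12³ ≤ 2¹¹ and every exponent occurring in S is at most 11 t + 11.
-- Hence 0 ≤ S ≤ 6 B² < 2⁵ B² = 2 ^ (22 t + 27).

sq≡+∣i∣*∣i∣ : ∀ i → sq i ≡ + (ℤ.∣ i ∣ * ℤ.∣ i ∣)
sq≡+∣i∣*∣i∣ (+ n)    = sym (ℤ.pos-* n n)
sq≡+∣i∣*∣i∣ -[1+ n ] = refl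

0≤sq : ∀ i → + 0 ℤ.≤ sq i
0≤sq i = subst (+ 0 ℤ.≤_) (sym (sq≡+∣i∣*∣i∣ i)) (ℤ.+≤+ z≤n)

∣m⊝n∣≤m⊔n : ∀ m n → ℤ.∣ m ⊝ n ∣ ≤ m ℕ.⊔ n
∣m⊝n∣≤m⊔n m n = subst (_≤ m ℕ.⊔ n) (cong ℤ.∣_∣ (sym (ℤ.m-n≡m⊖n m n))) (ℤ.∣m⊝n∣≤m⊔n m n)

sq-⊝-≤ : ∀ {x y} k → x ≤ 2 ^ k → y ≤ 2 ^ k → sq (x ⊝ y) ℤ.≤ + 2 ^ (k + k)
sq-⊝-≤ {x} {y} k x≤2^k y≤2^k = begin
  sq (x ⊝ y)                      ≡⟨ sq≡+∣i∣*∣i∣ (x ⊝ y) ⟩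
  + (ℤ.∣ x ⊝ y ∣ * ℤ.∣ x ⊝ y ∣)   ≤⟨ ℤ.+≤+ (*-mono-≤ ∣x⊝y∣≤2^k ∣x⊝y∣≤2^k) ⟩
  + (2 ^ k * 2 ^ k)               ≡⟨ cong +_ (sym (^-distribˡ-+-* 2 k k)) ⟩
  + 2 ^ (k + k)                   ∎
  where
  open ℤ.≤-Reasoning
  ∣x⊝y∣≤2^k : ℤ.∣ x ⊝ y ∣ ≤ 2 ^ k
  ∣x⊝y∣≤2^k = ≤-trans (∣m⊝n∣≤m⊔n x y) (⊔-lub x≤2^k y≤2^k)

n≤2^n : ∀ n → n ≤ 2 ^ n
n≤2^n zero    = z≤n
n≤2^n (suc n) = +-mono-≤ (m^n>0 2 n) (m≤n⇒m≤n+o 0 (n≤2^n n))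

m*n≤2^[m+n] : ∀ m n → m * n ≤ 2 ^ (m + n)
m*n≤2^[m+n] m n =
  subst (m * n ≤_) (sym (^-distribˡ-+-* 2 m n)) (*-mono-≤ (n≤2^n m) (n≤2^n n))

12^[3n+2]≤2^[11n+11] : ∀ n → 12 ^ (3 * n + 2) ≤ 2 ^ (11 * n + 11)
12^[3n+2]≤2^[11n+11] n = begin
  12 ^ (3 * n + 2)        ≡⟨ ^-distribˡ-+-* 12 (3 * n) 2 ⟩
  12 ^ (3 * n) * 12 ^ 2   ≡⟨ cong (_* 12 ^ 2) (sym (^-*-assoc 12 3 n)) ⟩
  (12 ^ 3) ^ n * 12 ^ 2   ≤⟨ *-mono-≤ (^-monoˡ-≤ n (≤ᵇ⇒≤ (12 ^ 3) (2 ^ 11) tt))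
                                      (≤ᵇ⇒≤ (12 ^ 2) (2 ^ 11) tt) ⟩
  (2 ^ 11) ^ n * 2 ^ 11   ≡⟨ cong (_* 2 ^ 11) (^-*-assoc 2 11 n) ⟩
  2 ^ (11 * n) * 2 ^ 11   ≡⟨ sym (^-distribˡ-+-* 2 (11 * n) 11) ⟩
  2 ^ (11 * n + 11)       ∎
  where open ≤-Reasoning

module _ {t : ℕ} where

  var≤11t+11 : ∀ {u} → u ≤ t → u ≤ 11 * t + 11
  var≤11t+11 u≤t = ≤-trans u≤t (≤-trans (m≤n*m t 11) (m≤m+n (11 * t) 11))

  sum≤11t+11 : ∀ {u v} → u ≤ t → v ≤ t → u + v ≤ 11 * t + 11
  sum≤11t+11 u≤t v≤t = ≤-trans (+-mono-≤ u≤t v≤t)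
    (≤-trans (+-monoʳ-≤ t (m≤n*m t 10)) (m≤m+n (11 * t) 11))

  weighted≤11t+11 : ∀ p q {u v} → p + q ≤ 11 → u ≤ t → v ≤ t →
                    p * u + q * v ≤ 11 * t + 11
  weighted≤11t+11 p q {u} {v} p+q≤11 u≤t v≤t = begin
    p * u + q * v   ≤⟨ +-mono-≤ (*-monoʳ-≤ p u≤t) (*-monoʳ-≤ q v≤t) ⟩
    p * t + q * t   ≡⟨ sym (*-distribʳ-+ t p q) ⟩
    (p + q) * t     ≤⟨ *-monoˡ-≤ t p+q≤11 ⟩
    11 * t          ≤⟨ m≤m+n (11 * t) 11 ⟩
    11 * t + 11     ∎
    where open ≤-Reasoning

  12^[3u+2]≤2^[11t+11] : ∀ {u} → u ≤ t → 12 ^ (3 * u + 2) ≤ 2 ^ (11 * t + 11)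
  12^[3u+2]≤2^[11t+11] {u} u≤t = ≤-trans (12^[3n+2]≤2^[11n+11] u)
    (^-monoʳ-≤ 2 (+-monoˡ-≤ 11 (*-monoʳ-≤ 11 u≤t)))

  var≤2^[11t+11] : ∀ {u} → u ≤ t → u ≤ 2 ^ (11 * t + 11)
  var≤2^[11t+11] {u} u≤t = ≤-trans (n≤2^n u) (^-monoʳ-≤ 2 (var≤11t+11 u≤t))

  product≤2^[11t+11] : ∀ {u v} → u ≤ t → v ≤ t → u * v ≤ 2 ^ (11 * t + 11)
  product≤2^[11t+11] {u} {v} u≤t v≤t =
    ≤-trans (m*n≤2^[m+n] u v) (^-monoʳ-≤ 2 (sum≤11t+11 u≤t v≤t))

sixfold-< : ∀ m → let P = 2 ^ m in P + P + P + P + P + P < 2 ^ (m + 5)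
sixfold-< m = begin-strict
  P + P + P + P + P + P ≡⟨ sixfold P ⟩
  6 * P                 <⟨ *-monoˡ-< P {{m^n≢0 2 m}} {6} {32} (≤ᵇ⇒≤ 7 32 tt) ⟩
  2 ^ 5 * P             ≡⟨ *-comm (2 ^ 5) P ⟩
  P * 2 ^ 5             ≡⟨ sym (^-distribˡ-+-* 2 m 5) ⟩
  2 ^ (m + 5)           ∎
  where
  open ≤-Reasoning
  P : ℕ
  P = 2 ^ m
  sixfold : ∀ x → x + x + x + x + x + x ≡ 6 * x
  sixfold = solve-∀

infixl 6 _⊕_
_⊕_ : ∀ {i j k l} → i ℤ.≤ j → k ℤ.≤ l → i ℤ.+ k ℤ.≤ j ℤ.+ l
_⊕_ = ℤ.+-mono-≤

0≤S : ∀ n g v a b c d e → + 0 ℤ.≤ S n g v a b c d e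
0≤S n g v a b c d e =
  0≤sq (c ⊝ 12 ^ (3 * g + 2)) ⊕ 0≤sq (d ⊝ a * g) ⊕ 0≤sq (e ⊝ b * g)
    ⊕ 0≤sq (2 ^ n ⊝ 2 ^ (g + v)) ⊕ 0≤sq (2 ^ c ⊝ 2 ^ (3 * d + 2 * a))
    ⊕ 0≤sq (2 ^ (c + 1) ⊝ 2 ^ (6 * e + 5 * b))

S≤sixfold : ∀ {n t g v a b c d e} →
            n ≤ t → g ≤ t → v ≤ t → a ≤ t → b ≤ t → c < t → d ≤ t → e ≤ t →
            let P = 2 ^ ((11 * t + 11) + (11 * t + 11)) in
            S n g v a b c d e ℤ.≤ + (P + P + P + P + P + P)
S≤sixfold {n} {t} {g} {v} {a} {b} {c} {d} {e} n≤t g≤t v≤t a≤t b≤t c<t d≤t e≤t =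
  bound₁ ⊕ bound₂ ⊕ bound₃ ⊕ bound₄ ⊕ bound₅ ⊕ bound₆
  where
  K : ℕ
  K = 11 * t + 11

  P : ℕ
  P = 2 ^ (K + K)

  c≤t : c ≤ t
  c≤t = <⇒≤ c<t

  c+1≤t : c + 1 ≤ t
  c+1≤t = subst (_≤ t) (+-comm 1 c) c<t

  bound₁ : sq (c ⊝ 12 ^ (3 * g + 2)) ℤ.≤ + P
  bound₁ = sq-⊝-≤ K (var≤2^[11t+11] c≤t) (12^[3u+2]≤2^[11t+11] g≤t)

  bound₂ : sq (d ⊝ a * g) ℤ.≤ + P
  bound₂ = sq-⊝-≤ K (var≤2^[11t+11] d≤t) (product≤2^[11t+11] a≤t g≤t)

  bound₃ : sq (e ⊝ b * g) ℤ.≤ + P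
  bound₃ = sq-⊝-≤ K (var≤2^[11t+11] e≤t) (product≤2^[11t+11] b≤t g≤t)

  bound₄ : sq (2 ^ n ⊝ 2 ^ (g + v)) ℤ.≤ + P
  bound₄ = sq-⊝-≤ K (^-monoʳ-≤ 2 (var≤11t+11 n≤t)) (^-monoʳ-≤ 2 (sum≤11t+11 g≤t v≤t))

  bound₅ : sq (2 ^ c ⊝ 2 ^ (3 * d + 2 * a)) ℤ.≤ + P
  bound₅ = sq-⊝-≤ K (^-monoʳ-≤ 2 (var≤11t+11 c≤t))
                    (^-monoʳ-≤ 2 (weighted≤11t+11 3 2 (≤ᵇ⇒≤ 5 11 tt) d≤t a≤t))

  bound₆ : sq (2 ^ (c + 1) ⊝ 2 ^ (6 * e + 5 * b)) ℤ.≤ + P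
  bound₆ = sq-⊝-≤ K (^-monoʳ-≤ 2 (var≤11t+11 c+1≤t))
                    (^-monoʳ-≤ 2 (weighted≤11t+11 6 5 ≤-refl e≤t b≤t))

mainTheorem9 : ∀ (n t : ℕ) → n ℕ.< t →
    ∀ (g v a b c d e : ℕ) →
    g ℕ.< t → v ℕ.< t → a ℕ.< t → b ℕ.< t → c ℕ.< t → d ℕ.< t → e ℕ.< t →
    (+ 0 ℤ.≤ S n g v a b c d e) × (S n g v a b c d e ℤ.< + (2 ^ (22 ℕ.* t ℕ.+ 27)))
mainTheorem9 n t n<t g v a b c d e g<t v<t a<t b<t c<t d<t e<t =
  0≤S n g v a b c d e ,
  ℤ.≤-<-trans
    (S≤sixfold (<⇒≤ n<t) (<⇒≤ g<t) (<⇒≤ v<t) (<⇒≤ a<t) (<⇒≤ b<t) c<t (<⇒≤ d<t) (<⇒≤ e<t))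
    (ℤ.+<+ (subst (λ m → P + P + P + P + P + P < 2 ^ m) (exponent t) (sixfold-< k)))
  where
  k : ℕ
  k = (11 * t + 11) + (11 * t + 11)

  P : ℕ
  P = 2 ^ k

  exponent : ∀ t → (11 * t + 11) + (11 * t + 11) + 5 ≡ 22 * t + 27
  exponent = solve-∀
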